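{- Let $k\ge0$. For any $y\in F_k$ with $y=y^{(k)}_j$ for some $j\ge1$, \[y^{(k)}_{j+1}=\begin{cases} y+f_{2k+3}, & \text{if } y\in F'_k,\\ y+f_{2k+2}, & \text{if } y\in F''_k.\end{cases}\]
   Context: Define $f_0=1$, $f_1=2$, $f_{2j+2}=f_{2j}+f_{2j+1}$, $f_{2j+3}=f_{2j}+f_{2j+2}$ (the $f_{2j+1}$ are even). Every integer $n\ge0$ has a unique representation $n=\sum_{i\ge0}a_i(n)f_i$ with $a_i(n)\in\{0,1\}$, finitely many nonzero, $a_ia_{i+1}=0$ for all $i$, and $a_ia_{i+2}=0$ for all even $i$. For $k\ge0$ put $\Phi_k(n)=\sum_{i=0}^{2k+2}a_i(n)f_i$. Let $\mathbb{N}=\{0,1,\dots\}$. For $k\ge0$, $F_k=\{y\in\mathbb{N}:\Phi_k(y)=f_{2k+1}/2\}=\{y^{(k)}_1<y^{(k)}_2<\cdots\}$ (increasing enumeration), $F'_k=\{y\in\mathbb{N}:\Phi_{k+1}(y)=f_{2k+1}/2\}$, and $F''_k=F_k\setminus F'_k$. -}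

module Defs where

open import Data.Nat using (ℕ; zero; suc; _+_; _*_; _<_; ⌊_/2⌋)
open import Data.Bool using (Bool; true; false; not; if_then_else_)
open import Data.List using (List; []; _∷_; length)
open import Data.Product using (Σ; _×_; ∃)
open import Relation.Binary.PropositionalEquality using (_≡_)
open import Data.Empty using (⊥)

-- fe j = f_{2j},  fo j = f_{2j+1}
fe fo : ℕ → ℕ
fe zero = 1
fe (suc j) = fe j + fo j
fo zero = 2
fo (suc j) = fe j + fe (suc j)

isOdd : ℕ → Bool
isOdd zero = false
isOdd (suc n) = not (isOdd n)

f : ℕ → ℕ
f n = if isOdd n then fo ⌊ n /2⌋ else fe ⌊ n /2⌋

-- a digit string (finitely many nonzero digits); a_i = digit a i (false beyond the list)
digit : List Bool → ℕ → Bool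
digit [] i = false
digit (b ∷ bs) zero = b
digit (b ∷ bs) (suc i) = digit bs i

psum : ℕ → List Bool → ℕ
psum zero a = 0
psum (suc m) a = psum m a + (if digit a m then f m else 0)

value : List Bool → ℕ
value a = psum (length a) a

IsRep : ℕ → List Bool → Set
IsRep n a =
  (value a ≡ n)
  × (∀ i → digit a i ≡ true → digit a (suc i) ≡ false)
  × (∀ j → digit a (2 * j) ≡ true → digit a (2 * j + 2) ≡ false)

-- Φ_k(n) = c  :  Σ_{i=0}^{2k+2} a_i(n) f_i = c for the representation of n
PhiIs : ℕ → ℕ → ℕ → Set
PhiIs k n c = Σ (List Bool) λ a → IsRep n a × (psum (2 * k + 3) a ≡ c)

-- F_k, F'_k, F''_k  (f_{2k+1} is even, so ⌊ f_{2k+1} / 2 ⌋ = f_{2k+1}/2)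
InF : ℕ → ℕ → Set
InF k y = PhiIs k y ⌊ f (2 * k + 1) /2⌋

InF' : ℕ → ℕ → Set
InF' k y = PhiIs (suc k) y ⌊ f (2 * k + 1) /2⌋

-- z is the successor of y in the increasing enumeration of F_k
-- (i.e. y = y^{(k)}_j and z = y^{(k)}_{j+1})
NextInF : ℕ → ℕ → ℕ → Set
NextInF k y z = InF k z × (y < z) × (∀ w → y < w → w < z → InF k w → ⊥)

-- Write c = f_{2k+1}/2 and m = 2k+3, so that y ∈ F_k iff the digits of y below m contribute c.
-- Comparing two admissible representations from the top digit down, a representation b with the
-- same low part c exceeds a by at least g as soon as Σ_{i<N} a_i f_i + g ≤ f_N + c for all N ≥ m.
-- Admissibility propagates this inequality upward from three consecutive N (two, from an even N)
-- via f_{2j+2} = f_{2j} + f_{2j+1} and f_{2j+3} = f_{2j} + f_{2j+2}. It holds with g = f_{2k+2}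
-- for every y ∈ F_k, and with g = f_m when digits m and m+1 of y vanish, i.e. when y ∈ F'_k.
-- So the successor is y + f_m, obtained by setting digit m, when y ∈ F'_k, and otherwise
-- y + f_{2k+2}, computed by carrying upward with the same two identities; neither step changes
-- the digits below m.
module Submission where

open import Defs
open import Data.Bool using (Bool; true; false; not; if_then_else_)
open import Data.Bool.Properties using (not-involutive)
open import Data.Empty using (⊥; ⊥-elim)
open import Data.List using (List; []; _∷_; length)
open import Data.Nat using (ℕ; zero; suc; _+_; _*_; _∸_; _≤_; _<_; z≤n; s≤s; ⌊_/2⌋; _≟_)
open import Data.Nat.Properties
open import Algebra.Properties.CommutativeSemigroup +-commutativeSemigroup using (xy∙z≈xz∙y; x∙yz≈xz∙y)
open import Data.Product using (Σ; _×_; _,_; proj₁; proj₂)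
open import Data.Sum using (_⊎_; inj₁; inj₂)
open import Relation.Nullary using (¬_; yes; no)
open import Relation.Binary.PropositionalEquality
open import Function using (_∘_)

double : ℕ → ℕ
double zero = zero
double (suc j) = suc (suc (double j))

2*≡double : ∀ j → 2 * j ≡ double j
2*≡double zero = refl
2*≡double (suc j) = trans (*-suc 2 j) (cong (2 +_) (2*≡double j))

isOdd-double : ∀ j → isOdd (double j) ≡ false
isOdd-double zero = refl
isOdd-double (suc j) = trans (not-involutive _) (isOdd-double j)

double≢1+double : ∀ j i → double j ≢ 1 + double i
double≢1+double j i eq
  with trans (sym (isOdd-double j)) (trans (cong isOdd eq) (cong not (isOdd-double i)))
... | ()

⌊double/2⌋≡id : ∀ j → ⌊ double j /2⌋ ≡ j
⌊double/2⌋≡id zero = refl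
⌊double/2⌋≡id (suc j) = cong suc (⌊double/2⌋≡id j)

⌊1+double/2⌋≡id : ∀ j → ⌊ 1 + double j /2⌋ ≡ j
⌊1+double/2⌋≡id zero = refl
⌊1+double/2⌋≡id (suc j) = cong suc (⌊1+double/2⌋≡id j)

f-double : ∀ j → f (double j) ≡ fe j
f-double j rewrite isOdd-double j | ⌊double/2⌋≡id j = refl

f-1+double : ∀ j → f (1 + double j) ≡ fo j
f-1+double j rewrite isOdd-double j | ⌊1+double/2⌋≡id j = refl

f-even-rec : ∀ j → f (2 + double j) ≡ f (double j) + f (1 + double j)
f-even-rec j = begin
  f (double (suc j))             ≡⟨ f-double (suc j) ⟩
  fe j + fo j                    ≡⟨ sym (cong₂ _+_ (f-double j) (f-1+double j)) ⟩
  f (double j) + f (1 + double j) ∎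
  where open ≡-Reasoning

f-odd-rec : ∀ j → f (3 + double j) ≡ f (double j) + f (2 + double j)
f-odd-rec j = begin
  f (1 + double (suc j))              ≡⟨ f-1+double (suc j) ⟩
  fe j + fe (suc j)                   ≡⟨ sym (cong₂ _+_ (f-double j) (f-double (suc j))) ⟩
  f (double j) + f (double (suc j))   ∎
  where open ≡-Reasoning

parity : ∀ n → Σ ℕ (λ j → n ≡ double j) ⊎ Σ ℕ (λ j → n ≡ 1 + double j)
parity zero = inj₁ (0 , refl)
parity (suc n) with parity n
... | inj₁ (j , refl) = inj₂ (j , refl)
... | inj₂ (j , refl) = inj₁ (suc j , refl)

f-≤-suc : ∀ n → f n ≤ f (suc n)
f-≤-suc n with parity n
... | inj₁ (zero , refl) = s≤s z≤n
... | inj₁ (suc j , refl) = ≤-trans (m≤n+m _ (f (double j))) (≤-reflexive (sym (f-odd-rec j)))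
... | inj₂ (j , refl) = ≤-trans (m≤n+m _ (f (double j))) (≤-reflexive (sym (f-even-rec j)))

0<f : ∀ n → 0 < f n
0<f zero = s≤s z≤n
0<f (suc n) = ≤-trans (0<f n) (f-≤-suc n)

weight : Bool → ℕ → ℕ
weight b n = if b then f n else 0

2*+2≡2+double : ∀ j → 2 * j + 2 ≡ 2 + double j
2*+2≡2+double j = trans (+-comm (2 * j) 2) (cong (2 +_) (2*≡double j))

Admissible : List Bool → Set
Admissible a = (∀ i → digit a i ≡ true → digit a (suc i) ≡ false)
             × (∀ j → digit a (2 * j) ≡ true → digit a (2 * j + 2) ≡ false)

module _ {a : List Bool} (adm : Admissible a) where

  digit-suc-false : ∀ i → digit a i ≡ true → digit a (suc i) ≡ false
  digit-suc-false = proj₁ adm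

  digit-pred-false : ∀ i → digit a (suc i) ≡ true → digit a i ≡ false
  digit-pred-false i a[1+i] with digit a i in a[i]
  ... | false = refl
  ... | true with trans (sym a[1+i]) (digit-suc-false i a[i])
  ...   | ()

  digit-2+double-false : ∀ j → digit a (double j) ≡ true → digit a (2 + double j) ≡ false
  digit-2+double-false j a[2j] = subst₂ (λ n m → digit a n ≡ true → digit a m ≡ false)
    (2*≡double j) (2*+2≡2+double j) (proj₂ adm j) a[2j]

  digit-double-false : ∀ j → digit a (2 + double j) ≡ true → digit a (double j) ≡ false
  digit-double-false j a[2+2j] with digit a (double j) in a[2j]
  ... | false = refl
  ... | true with trans (sym a[2+2j]) (digit-2+double-false j a[2j])
  ...   | ()

digit-≥-length : ∀ a {i} → length a ≤ i → digit a i ≡ false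
digit-≥-length [] _ = refl
digit-≥-length (b ∷ a) {suc i} (s≤s len≤i) = digit-≥-length a len≤i

psum-cong : ∀ N {a b} → (∀ i → i < N → digit a i ≡ digit b i) → psum N a ≡ psum N b
psum-cong zero eq = refl
psum-cong (suc N) eq = cong₂ (λ s d → s + weight d N)
  (psum-cong N (λ i i<N → eq i (m<n⇒m<1+n i<N))) (eq N (n<1+n N))

psum-≤-+ : ∀ a d N → psum N a ≤ psum (d + N) a
psum-≤-+ a zero N = ≤-refl
psum-≤-+ a (suc d) N = ≤-trans (psum-≤-+ a d N) (m≤m+n _ _)

f≤psum : ∀ a n → digit a n ≡ true → f n ≤ psum (suc n) a
f≤psum a n a[n] rewrite a[n] = m≤n+m (f n) (psum n a)

psum-beyond : ∀ a N → (∀ i → N ≤ i → digit a i ≡ false) → ∀ d → psum (d + N) a ≡ psum N a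
psum-beyond a N zeros zero = refl
psum-beyond a N zeros (suc d) rewrite zeros (d + N) (m≤n+m N d) =
  trans (+-identityʳ _) (psum-beyond a N zeros d)

value≡psum : ∀ a N → (∀ i → N ≤ i → digit a i ≡ false) → value a ≡ psum N a
value≡psum a N zeros with ≤-total (length a) N
... | inj₁ len≤N = begin
  psum (length a) a
    ≡⟨ sym (psum-beyond a (length a) (λ i → digit-≥-length a) (N ∸ length a)) ⟩
  psum (N ∸ length a + length a) a
    ≡⟨ cong (λ n → psum n a) (m∸n+n≡m len≤N) ⟩
  psum N a ∎
  where open ≡-Reasoning
... | inj₂ N≤len = begin
  psum (length a) a          ≡⟨ cong (λ n → psum n a) (sym (m∸n+n≡m N≤len)) ⟩
  psum (length a ∸ N + N) a  ≡⟨ psum-beyond a N zeros (length a ∸ N) ⟩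
  psum N a                   ∎
  where open ≡-Reasoning

small-psum⇒digit≡false : ∀ a {n N c} → psum N a ≡ c → c < f n → n < N → digit a n ≡ false
small-psum⇒digit≡false a {n} {N} refl c<fn n<N with digit a n in a[n]
... | false = refl
... | true = ⊥-elim (<⇒≱ c<fn (begin
  f n                         ≤⟨ f≤psum a n a[n] ⟩
  psum (suc n) a              ≤⟨ psum-≤-+ a (N ∸ suc n) (suc n) ⟩
  psum (N ∸ suc n + suc n) a  ≡⟨ cong (λ m → psum m a) (m∸n+n≡m n<N) ⟩
  psum N a                    ∎))
  where open ≤-Reasoning

setDigit : List Bool → ℕ → Bool → List Bool
setDigit []      zero    v = v ∷ []
setDigit []      (suc p) v = false ∷ setDigit [] p v
setDigit (b ∷ a) zero    v = v ∷ a
setDigit (b ∷ a) (suc p) v = b ∷ setDigit a p v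

digit-setDigit-≡ : ∀ a p v → digit (setDigit a p v) p ≡ v
digit-setDigit-≡ []      zero    v = refl
digit-setDigit-≡ []      (suc p) v = digit-setDigit-≡ [] p v
digit-setDigit-≡ (b ∷ a) zero    v = refl
digit-setDigit-≡ (b ∷ a) (suc p) v = digit-setDigit-≡ a p v

digit-setDigit-≢ : ∀ a p v {i} → i ≢ p → digit (setDigit a p v) i ≡ digit a i
digit-setDigit-≢ []      zero    v {zero}  i≢p = ⊥-elim (i≢p refl)
digit-setDigit-≢ []      zero    v {suc i} i≢p = refl
digit-setDigit-≢ []      (suc p) v {zero}  i≢p = refl
digit-setDigit-≢ []      (suc p) v {suc i} i≢p = digit-setDigit-≢ [] p v (i≢p ∘ cong suc)
digit-setDigit-≢ (b ∷ a) zero    v {zero}  i≢p = ⊥-elim (i≢p refl)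
digit-setDigit-≢ (b ∷ a) zero    v {suc i} i≢p = refl
digit-setDigit-≢ (b ∷ a) (suc p) v {zero}  i≢p = refl
digit-setDigit-≢ (b ∷ a) (suc p) v {suc i} i≢p = digit-setDigit-≢ a p v (i≢p ∘ cong suc)

digit-setDigit-< : ∀ a p v {i} → i < p → digit (setDigit a p v) i ≡ digit a i
digit-setDigit-< a p v i<p = digit-setDigit-≢ a p v (<⇒≢ i<p)

digit-setDigit-> : ∀ a p v {i} → p < i → digit (setDigit a p v) i ≡ digit a i
digit-setDigit-> a p v p<i = digit-setDigit-≢ a p v (>⇒≢ p<i)

psum-setDigit : ∀ a p v N → p < N →
  psum N (setDigit a p v) + weight (digit a p) p ≡ psum N a + weight v p
psum-setDigit a p v (suc N) p<1+N with p ≟ N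
... | yes refl = begin
  psum p a′ + weight (digit a′ p) p + weight (digit a p) p
    ≡⟨ cong₂ (λ s d → s + weight d p + weight (digit a p) p)
         (psum-cong p (λ i → digit-setDigit-< a p v)) (digit-setDigit-≡ a p v) ⟩
  psum p a + weight v p + weight (digit a p) p
    ≡⟨ xy∙z≈xz∙y (psum p a) (weight v p) (weight (digit a p) p) ⟩
  psum p a + weight (digit a p) p + weight v p ∎
  where open ≡-Reasoning
        a′ = setDigit a p v
... | no p≢N = begin
  psum N a′ + weight (digit a′ N) N + weight (digit a p) p
    ≡⟨ cong (λ d → psum N a′ + weight d N + weight (digit a p) p) (digit-setDigit-≢ a p v (p≢N ∘ sym)) ⟩
  psum N a′ + weight (digit a N) N + weight (digit a p) p
    ≡⟨ xy∙z≈xz∙y (psum N a′) (weight (digit a N) N) (weight (digit a p) p) ⟩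
  psum N a′ + weight (digit a p) p + weight (digit a N) N
    ≡⟨ cong (_+ weight (digit a N) N) (psum-setDigit a p v N (≤∧≢⇒< (≤-pred p<1+N) p≢N)) ⟩
  psum N a + weight v p + weight (digit a N) N
    ≡⟨ xy∙z≈xz∙y (psum N a) (weight v p) (weight (digit a N) N) ⟩
  psum N a + weight (digit a N) N + weight v p ∎
  where open ≡-Reasoning
        a′ = setDigit a p v

value-setDigit : ∀ a p v → value (setDigit a p v) + weight (digit a p) p ≡ value a + weight v p
value-setDigit a p v = begin
  value a′ + weight (digit a p) p  ≡⟨ cong (_+ weight (digit a p) p) (value≡psum a′ N zeros′) ⟩
  psum N a′ + weight (digit a p) p ≡⟨ psum-setDigit a p v N (m≤m+n (suc p) (length a)) ⟩
  psum N a + weight v p            ≡⟨ cong (_+ weight v p) (sym (value≡psum a N zeros)) ⟩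
  value a + weight v p             ∎
  where
  open ≡-Reasoning
  a′ = setDigit a p v
  N = suc p + length a
  zeros : ∀ i → N ≤ i → digit a i ≡ false
  zeros i N≤i = digit-≥-length a (≤-trans (m≤n+m (length a) (suc p)) N≤i)
  zeros′ : ∀ i → N ≤ i → digit a′ i ≡ false
  zeros′ i N≤i = trans (digit-setDigit-> a p v (≤-trans (m≤m+n (suc p) (length a)) N≤i)) (zeros i N≤i)

value-set : ∀ a p → digit a p ≡ false → value (setDigit a p true) ≡ value a + f p
value-set a p a[p] = trans (sym (+-identityʳ _))
  (subst (λ d → value (setDigit a p true) + weight d p ≡ value a + f p) a[p] (value-setDigit a p true))

value-clear : ∀ a p → digit a p ≡ true → value (setDigit a p false) + f p ≡ value a
value-clear a p a[p] = trans
  (subst (λ d → value (setDigit a p false) + weight d p ≡ value a + 0) a[p] (value-setDigit a p false))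
  (+-identityʳ _)

digit-clear-false : ∀ a p {i} → digit a i ≡ false → digit (setDigit a p false) i ≡ false
digit-clear-false a p {i} a[i] with i ≟ p
... | yes refl = digit-setDigit-≡ a p false
... | no i≢p = trans (digit-setDigit-≢ a p false i≢p) a[i]

Admissible-clear : ∀ a p → Admissible a → Admissible (setDigit a p false)
Admissible-clear a p adm =
  (λ i h → digit-clear-false a p (digit-suc-false {a} adm i (kept i h))) ,
  (λ j h → digit-clear-false a p (proj₂ adm j (kept (2 * j) h)))
  where
  kept : ∀ i → digit (setDigit a p false) i ≡ true → digit a i ≡ true
  kept i h with digit a i in a[i]
  ... | true = refl
  ... | false with trans (sym h) (digit-clear-false a p a[i])
  ...   | ()

Admissible-set : ∀ a p → Admissible a →
  (∀ i → suc i ≡ p → digit a i ≡ false) → digit a (suc p) ≡ false →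
  (∀ j → double j ≡ p → digit a (2 + p) ≡ false) →
  (∀ j → 2 + double j ≡ p → digit a (double j) ≡ false) →
  Admissible (setDigit a p true)
Admissible-set a p (adj , even) left right left₂ right₂ = adj′ , even′
  where
  a′ = setDigit a p true
  unchanged : ∀ {i} → i ≢ p → digit a′ i ≡ digit a i
  unchanged = digit-setDigit-≢ a p true
  adj′ : ∀ i → digit a′ i ≡ true → digit a′ (suc i) ≡ false
  adj′ i h with i ≟ p | suc i ≟ p
  ... | yes refl | _ = trans (unchanged (λ ())) right
  ... | no i≢p | yes 1+i≡p with trans (sym (trans (sym (unchanged i≢p)) h)) (left i 1+i≡p)
  ...   | ()
  adj′ i h | no i≢p | no 1+i≢p = trans (unchanged 1+i≢p) (adj i (trans (sym (unchanged i≢p)) h))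
  even″ : ∀ j → digit a′ (double j) ≡ true → digit a′ (2 + double j) ≡ false
  even″ j h with double j ≟ p | 2 + double j ≟ p
  ... | yes refl | _ = trans (unchanged (λ e → <-irrefl (sym e) (m<n+m (double j) (s≤s z≤n)))) (left₂ j refl)
  ... | no 2j≢p | yes 2+2j≡p with trans (sym (trans (sym (unchanged 2j≢p)) h)) (right₂ j 2+2j≡p)
  ...   | ()
  even″ j h | no 2j≢p | no 2+2j≢p = trans (unchanged 2+2j≢p)
    (digit-2+double-false {a} (adj , even) j (trans (sym (unchanged 2j≢p)) h))
  even′ : ∀ j → digit a′ (2 * j) ≡ true → digit a′ (2 * j + 2) ≡ false
  even′ j = subst₂ (λ n m → digit a′ n ≡ true → digit a′ m ≡ false)
    (sym (2*≡double j)) (sym (2*+2≡2+double j)) (even″ j)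

Admissible-set-odd : ∀ a j → Admissible a →
  digit a (2 + double j) ≡ false → digit a (4 + double j) ≡ false →
  Admissible (setDigit a (3 + double j) true)
Admissible-set-odd a j adm a[2+2j] a[4+2j] = Admissible-set a (3 + double j) adm
  (λ { i refl → a[2+2j] }) a[4+2j]
  (λ i 2i≡3+2j → ⊥-elim (double≢1+double i (suc j) 2i≡3+2j))
  (λ i 2+2i≡3+2j → ⊥-elim (double≢1+double (suc i) (suc j) 2+2i≡3+2j))

Admissible-set-even : ∀ a j → Admissible a →
  digit a (double j) ≡ false → digit a (1 + double j) ≡ false →
  digit a (3 + double j) ≡ false → digit a (4 + double j) ≡ false →
  Admissible (setDigit a (2 + double j) true)
Admissible-set-even a j adm a[2j] a[1+2j] a[3+2j] a[4+2j] = Admissible-set a (2 + double j) adm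
  (λ { i refl → a[1+2j] }) a[3+2j] (λ _ _ → a[4+2j])
  (λ i 2+2i≡2+2j → subst (λ n → digit a n ≡ false) (sym (+-cancelˡ-≡ 2 _ _ 2+2i≡2+2j)) a[2j])

psum-suc-false : ∀ a n → digit a n ≡ false → psum (suc n) a ≡ psum n a
psum-suc-false a n a[n] rewrite a[n] = +-identityʳ _

psum-suc-true : ∀ a n → digit a n ≡ true → psum (suc n) a ≡ psum n a + f n
psum-suc-true a n a[n] rewrite a[n] = refl

psum-2+-false : ∀ a n → digit a n ≡ false → digit a (1 + n) ≡ false → psum (2 + n) a ≡ psum n a
psum-2+-false a n a[n] a[1+n] = trans (psum-suc-false a (1 + n) a[1+n]) (psum-suc-false a n a[n])

-- If b has low part c and N is the top position where the digits of b and a differ, with b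
-- having the 1, then psum (suc N) b ≥ f N + c; Gap a c g N makes this exceed psum (suc N) a by g.
record Gap (a : List Bool) (c g N : ℕ) : Set where
  constructor mkGap
  field gap : psum N a + g ≤ f N + c
open Gap

Gap-suc-false : ∀ {a c g N} → digit a N ≡ false → Gap a c g N → Gap a c g (suc N)
Gap-suc-false {a} {c} {g} {N} a[N] (mkGap gap) = mkGap (begin
  psum (suc N) a + g  ≡⟨ cong (_+ g) (psum-suc-false a N a[N]) ⟩
  psum N a + g        ≤⟨ gap ⟩
  f N + c             ≤⟨ +-monoˡ-≤ c (f-≤-suc N) ⟩
  f (suc N) + c       ∎)
  where open ≤-Reasoning

Gap-shift : ∀ {a c g N M} F → psum M a ≡ psum N a + F → f M ≡ f N + F → Gap a c g N → Gap a c g M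
Gap-shift {a} {c} {g} {N} {M} F psum≡ f≡ (mkGap gap) = mkGap (begin
  psum M a + g      ≡⟨ cong (_+ g) psum≡ ⟩
  psum N a + F + g  ≡⟨ xy∙z≈xz∙y (psum N a) F g ⟩
  psum N a + g + F  ≤⟨ +-monoˡ-≤ F gap ⟩
  f N + c + F       ≡⟨ xy∙z≈xz∙y (f N) c F ⟩
  f N + F + c       ≡⟨ cong (_+ c) (sym f≡) ⟩
  f M + c           ∎)
  where open ≤-Reasoning

module _ {a : List Bool} (adm : Admissible a) {c g : ℕ} where

  Gap-step-even : ∀ j → Gap a c g (double j) → Gap a c g (1 + double j) → Gap a c g (2 + double j)
  Gap-step-even j gap₀ gap₁ with digit a (1 + double j) in a[1+2j]
  ... | false = Gap-suc-false a[1+2j] gap₁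
  ... | true = Gap-shift (f (1 + double j)) psum≡ (f-even-rec j) gap₀
    where
    psum≡ : psum (2 + double j) a ≡ psum (double j) a + f (1 + double j)
    psum≡ = trans (psum-suc-true a _ a[1+2j])
      (cong (_+ f (1 + double j)) (psum-suc-false a _ (digit-pred-false {a} adm _ a[1+2j])))

  Gap-step-odd : ∀ j → Gap a c g (double j) → Gap a c g (2 + double j) → Gap a c g (3 + double j)
  Gap-step-odd j gap₀ gap₂ with digit a (2 + double j) in a[2+2j]
  ... | false = Gap-suc-false a[2+2j] gap₂
  ... | true = Gap-shift (f (2 + double j)) psum≡ (f-odd-rec j) gap₀
    where
    psum≡ : psum (3 + double j) a ≡ psum (double j) a + f (2 + double j)
    psum≡ = trans (psum-suc-true a _ a[2+2j]) (cong (_+ f (2 + double j))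
      (psum-2+-false a _ (digit-double-false {a} adm j a[2+2j]) (digit-pred-false {a} adm _ a[2+2j])))

  Gap-step : ∀ n → Gap a c g n → Gap a c g (1 + n) → Gap a c g (2 + n) → Gap a c g (3 + n)
  Gap-step n gap₀ gap₁ gap₂ with parity n
  ... | inj₁ (j , refl) = Gap-step-odd j gap₀ gap₂
  ... | inj₂ (j , refl) = Gap-step-even (suc j) gap₁ gap₂

  Gap-upward : ∀ s → Gap a c g s → Gap a c g (1 + s) → Gap a c g (2 + s) → ∀ d → Gap a c g (d + s)
  Gap-upward s gap₀ gap₁ gap₂ d = proj₁ (window d)
    where
    window : ∀ d → Gap a c g (d + s) × Gap a c g (1 + d + s) × Gap a c g (2 + d + s)
    window zero = gap₀ , gap₁ , gap₂
    window (suc d) with window d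
    ... | gap₀′ , gap₁′ , gap₂′ = gap₁′ , gap₂′ , Gap-step (d + s) gap₀′ gap₁′ gap₂′

  Gap-upward-even : ∀ j → Gap a c g (double j) → Gap a c g (1 + double j) → ∀ d → Gap a c g (d + double j)
  Gap-upward-even j gap₀ gap₁ = Gap-upward (double j) gap₀ gap₁ (Gap-step-even j gap₀ gap₁)

psum<f : ∀ {a} → Admissible a → ∀ N → psum N a < f N
psum<f {a} adm N = subst₂ _≤_ (+-comm (psum N a) 1) (+-identityʳ (f N))
  (gap (subst (Gap a 0 1) (+-identityʳ N)
    (Gap-upward-even adm 0 (mkGap (s≤s z≤n)) (mkGap psum-1) N)))
  where
  psum-1 : psum 1 a + 1 ≤ f 1 + 0
  psum-1 with digit a 0
  ... | true = s≤s (s≤s z≤n)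
  ... | false = s≤s z≤n

module _ {a b : List Bool} {c g m : ℕ} (adm-b : Admissible b)
         (a≡c : psum m a ≡ c) (b≡c : psum m b ≡ c) (gaps : ∀ d → Gap a c g (d + m)) where

  psum-separated : ∀ d → psum (d + m) a < psum (d + m) b → psum (d + m) a + g ≤ psum (d + m) b
  psum-separated zero a<b = ⊥-elim (<-irrefl (trans a≡c (sym b≡c)) a<b)
  psum-separated (suc d) a<b with digit a (d + m) | digit b (d + m)
  ... | true | true = begin
    psum (d + m) a + f (d + m) + g  ≡⟨ xy∙z≈xz∙y (psum (d + m) a) (f (d + m)) g ⟩
    psum (d + m) a + g + f (d + m)  ≤⟨ +-monoˡ-≤ (f (d + m)) (psum-separated d (+-cancelʳ-< (f (d + m)) _ _ a<b)) ⟩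
    psum (d + m) b + f (d + m)      ∎
    where open ≤-Reasoning
  ... | false | false = subst₂ _≤_ (cong (_+ g) (sym (+-identityʳ _))) (sym (+-identityʳ _))
    (psum-separated d (subst₂ _<_ (+-identityʳ _) (+-identityʳ _) a<b))
  ... | true | false = ⊥-elim (<-asym a<b (begin-strict
    psum (d + m) b + 0           ≡⟨ +-identityʳ _ ⟩
    psum (d + m) b               <⟨ psum<f adm-b (d + m) ⟩
    f (d + m)                    ≤⟨ m≤n+m _ _ ⟩
    psum (d + m) a + f (d + m)   ∎))
    where open ≤-Reasoning
  ... | false | true = begin
    psum (d + m) a + 0 + g       ≡⟨ cong (_+ g) (+-identityʳ _) ⟩
    psum (d + m) a + g           ≤⟨ gap (gaps d) ⟩
    f (d + m) + c                ≤⟨ +-monoʳ-≤ (f (d + m)) (subst (_≤ psum (d + m) b) b≡c (psum-≤-+ b d m)) ⟩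
    f (d + m) + psum (d + m) b   ≡⟨ +-comm (f (d + m)) _ ⟩
    psum (d + m) b + f (d + m)   ∎
    where open ≤-Reasoning

  no-value-between : value a < value b → value b < value a + g → ⊥
  no-value-between a<b b<a+g = <-irrefl refl (<-≤-trans b<a+g
    (subst₂ (λ x y → x + g ≤ y) (sym va) (sym vb) (psum-separated L (subst₂ _<_ va vb a<b))))
    where
    L = length a + length b
    beyond : ∀ x → x ≤ L → ∀ i → L + m ≤ i → x ≤ i
    beyond x x≤L i L+m≤i = ≤-trans (≤-trans x≤L (m≤m+n L m)) L+m≤i
    va : value a ≡ psum (L + m) a
    va = value≡psum a (L + m) (λ i → digit-≥-length a ∘ beyond (length a) (m≤m+n _ _) i)
    vb : value b ≡ psum (L + m) b
    vb = value≡psum b (L + m) (λ i → digit-≥-length b ∘ beyond (length b) (m≤n+m _ _) i)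

Gap-vacant : ∀ {a c m} → Admissible a → psum m a ≡ c → digit a m ≡ false → digit a (1 + m) ≡ false →
  ∀ d → Gap a c (f m) (d + m)
Gap-vacant {a} {m = m} adm refl a[m] a[1+m] = Gap-upward adm m gap₀ gap₁ (Gap-suc-false a[1+m] gap₁)
  where
  gap₀ : Gap a (psum m a) (f m) m
  gap₀ = mkGap (≤-reflexive (+-comm (psum m a) (f m)))
  gap₁ : Gap a (psum m a) (f m) (1 + m)
  gap₁ = Gap-suc-false a[m] gap₀

Gap-double : ∀ {a c} j → Admissible a → psum (1 + double j) a ≡ c →
  ∀ d → Gap a c (f (double j)) (d + (1 + double j))
Gap-double {a} j adm refl d = subst (Gap a c (f (double j))) (sym (+-suc d (double j)))
  (Gap-upward-even adm j (mkGap gap₀) (mkGap gap₁) (suc d))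
  where
  c = psum (1 + double j) a
  gap₀ : psum (double j) a + f (double j) ≤ f (double j) + c
  gap₀ = subst (_≤ f (double j) + c) (+-comm (f (double j)) _) (+-monoʳ-≤ (f (double j)) (m≤m+n _ _))
  gap₁ : c + f (double j) ≤ f (1 + double j) + c
  gap₁ = subst (_≤ f (1 + double j) + c) (+-comm (f (double j)) c) (+-monoˡ-≤ c (f-≤-suc (double j)))

record Increment (a : List Bool) (E L : ℕ) : Set where
  constructor increment
  field
    sum        : List Bool
    admissible : Admissible sum
    value-sum  : value sum ≡ value a + f E
    agrees     : ∀ i → i < L → digit sum i ≡ digit a i

Increment-weaken : ∀ {a E L L′} → L′ ≤ L → Increment a E L → Increment a E L′
Increment-weaken L′≤L (increment b adm-b value-b agrees) =
  increment b adm-b value-b (λ i i<L′ → agrees i (<-≤-trans i<L′ L′≤L))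

Increment-set-even : ∀ a j → Admissible a →
  digit a (double j) ≡ false → digit a (1 + double j) ≡ false → digit a (2 + double j) ≡ false →
  digit a (3 + double j) ≡ false → digit a (4 + double j) ≡ false →
  Increment a (2 + double j) (2 + double j)
Increment-set-even a j adm a[2j] a[1+2j] a[2+2j] a[3+2j] a[4+2j] = increment
  (setDigit a (2 + double j) true)
  (Admissible-set-even a j adm a[2j] a[1+2j] a[3+2j] a[4+2j])
  (value-set a _ a[2+2j])
  (λ i → digit-setDigit-< a _ true)

-- f (2j) + f (2j+2) = f (2j+3): the digit 2j+2 moves up to 2j+3.
Increment-merge-even : ∀ a j → Admissible a → digit a (2 + double j) ≡ true →
  Increment a (double j) (1 + double j)
Increment-merge-even a j adm a[2+2j] = increment b
  (Admissible-set-odd a₁ j (Admissible-clear a _ adm) (digit-setDigit-≡ a _ false)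
    (trans (digit-setDigit-> a _ false (m<n⇒m<1+n (n<1+n _)))
           (digit-2+double-false {a} adm (suc j) a[2+2j])))
  (begin
    value b                                   ≡⟨ value-set a₁ _ a₁[3+2j] ⟩
    value a₁ + f (3 + double j)               ≡⟨ cong (value a₁ +_) (f-odd-rec j) ⟩
    value a₁ + (f (double j) + f (2 + double j)) ≡⟨ x∙yz≈xz∙y (value a₁) _ _ ⟩
    value a₁ + f (2 + double j) + f (double j) ≡⟨ cong (_+ f (double j)) (value-clear a _ a[2+2j]) ⟩
    value a + f (double j)                    ∎)
  (λ i i<1+2j → trans (digit-setDigit-< a₁ _ true (m<n⇒m<1+n (m<n⇒m<1+n i<1+2j)))
                      (digit-setDigit-< a _ false (m<n⇒m<1+n i<1+2j)))
  where
  open ≡-Reasoning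
  a₁ = setDigit a (2 + double j) false
  b = setDigit a₁ (3 + double j) true
  a₁[3+2j] : digit a₁ (3 + double j) ≡ false
  a₁[3+2j] = trans (digit-setDigit-> a _ false (n<1+n _)) (digit-suc-false {a} adm _ a[2+2j])

-- f (2j) + f (2j+1) = f (2j+2): the digit 2j+1 is removed and f (2j+2) is added instead.
Increment-merge-odd : ∀ a j → digit a (1 + double j) ≡ true →
  Increment (setDigit a (1 + double j) false) (2 + double j) (1 + double j) →
  Increment a (double j) (1 + double j)
Increment-merge-odd a j a[1+2j] (increment b adm-b value-b agrees) = increment b adm-b
  (begin
    value b                                      ≡⟨ value-b ⟩
    value a₁ + f (2 + double j)                  ≡⟨ cong (value a₁ +_) (f-even-rec j) ⟩
    value a₁ + (f (double j) + f (1 + double j)) ≡⟨ x∙yz≈xz∙y (value a₁) _ _ ⟩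
    value a₁ + f (1 + double j) + f (double j)   ≡⟨ cong (_+ f (double j)) (value-clear a _ a[1+2j]) ⟩
    value a + f (double j)                       ∎)
  (λ i i<1+2j → trans (agrees i i<1+2j) (digit-setDigit-< a _ false i<1+2j))
  where
  open ≡-Reasoning
  a₁ = setDigit a (1 + double j) false

≤1+double : ∀ j → j ≤ 1 + double j
≤1+double zero = z≤n
≤1+double (suc j) = s≤s (≤-trans (≤1+double j) (n≤1+n _))

Increment-carry : ∀ n j a → Admissible a → (∀ i → j + n ≤ i → digit a i ≡ false) →
  digit a (double j) ≡ false → digit a (1 + double j) ≡ true ⊎ digit a (2 + double j) ≡ true →
  Increment a (double j) (1 + double j)
Increment-carry n j a adm zeros a[2j] occupied with digit a (1 + double j) in a[1+2j]
Increment-carry n j a adm zeros a[2j] (inj₁ ()) | false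
Increment-carry n j a adm zeros a[2j] (inj₂ a[2+2j]) | false = Increment-merge-even a j adm a[2+2j]
Increment-carry zero j a adm zeros a[2j] _ | true
  with trans (sym a[1+2j]) (zeros _ (subst (_≤ 1 + double j) (sym (+-identityʳ j)) (≤1+double j)))
... | ()
Increment-carry (suc n) j a adm zeros a[2j] _ | true = Increment-merge-odd a j a[1+2j] carried
  where
  a₁ = setDigit a (1 + double j) false
  adm₁ : Admissible a₁
  adm₁ = Admissible-clear a _ adm
  a₁[2j] : digit a₁ (double j) ≡ false
  a₁[2j] = trans (digit-setDigit-< a _ false (n<1+n _)) a[2j]
  a₁[1+2j] : digit a₁ (1 + double j) ≡ false
  a₁[1+2j] = digit-setDigit-≡ a _ false
  a₁[2+2j] : digit a₁ (2 + double j) ≡ false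
  a₁[2+2j] = digit-clear-false a _ (digit-suc-false {a} adm _ a[1+2j])
  zeros₁ : ∀ i → suc j + n ≤ i → digit a₁ i ≡ false
  zeros₁ i j+n≤i = digit-clear-false a _ (zeros i (subst (_≤ i) (sym (+-suc j n)) j+n≤i))
  carried : Increment a₁ (2 + double j) (1 + double j)
  carried with digit a₁ (3 + double j) in a₁[3+2j] | digit a₁ (4 + double j) in a₁[4+2j]
  ... | true | _ = Increment-weaken (m≤n+m _ 2)
    (Increment-carry n (suc j) a₁ adm₁ zeros₁ a₁[2+2j] (inj₁ a₁[3+2j]))
  ... | false | true = Increment-weaken (m≤n+m _ 2)
    (Increment-carry n (suc j) a₁ adm₁ zeros₁ a₁[2+2j] (inj₂ a₁[4+2j]))
  ... | false | false = Increment-weaken (n≤1+n _)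
    (Increment-set-even a₁ j adm₁ a₁[2j] a₁[1+2j] a₁[2+2j] a₁[3+2j] a₁[4+2j])

2*k+n≡n+double : ∀ k n → 2 * k + n ≡ n + double k
2*k+n≡n+double k n = trans (+-comm (2 * k) n) (cong (n +_) (2*≡double k))

psum-2*k+n : ∀ a k n → psum (2 * k + n) a ≡ psum (n + double k) a
psum-2*k+n a k n = cong (λ i → psum i a) (2*k+n≡n+double k n)

target : ℕ → ℕ
target k = ⌊ f (2 * k + 1) /2⌋

target<f : ∀ k → target k < f (2 + double k)
target<f k = begin-strict
  ⌊ f (2 * k + 1) /2⌋            ≤⟨ ⌊n/2⌋≤n _ ⟩
  f (2 * k + 1)                  ≡⟨ cong f (2*k+n≡n+double k 1) ⟩
  f (1 + double k)               <⟨ m<n+m _ (0<f (double k)) ⟩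
  f (double k) + f (1 + double k) ≡⟨ sym (f-even-rec k) ⟩
  f (2 + double k)               ∎
  where open ≤-Reasoning

successor-in-F : ∀ k {y g a b} → IsRep y a → IsRep (y + g) b →
  psum (3 + double k) a ≡ target k → psum (3 + double k) b ≡ target k →
  (∀ d → Gap a (target k) g (d + (3 + double k))) → 0 < g → NextInF k y (y + g)
successor-in-F k {g = g} {a} {b} (refl , _) rep-b a≡c b≡c gaps 0<g =
  (b , rep-b , trans (psum-2*k+n b k 3) b≡c) , m<m+n _ 0<g , between
  where
  between : ∀ w → value a < w → w < value a + g → InF k w → ⊥
  between w a<w w<a+g (a′ , (refl , adm-a′) , a′≡c) =
    no-value-between adm-a′ a≡c (trans (sym (psum-2*k+n a′ k 3)) a′≡c) gaps a<w w<a+g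

successor-in-F′ : ∀ k {y a} → IsRep y a → psum (2 * suc k + 3) a ≡ target k →
  NextInF k y (y + f (2 * k + 3))
successor-in-F′ k {y} {a} rep@(value-a , adm) a≡c =
  subst (λ n → NextInF k y (y + f n)) (sym (2*k+n≡n+double k 3))
    (successor-in-F k rep rep-b a≡c₃ b≡c (Gap-vacant adm a≡c₃ a[3+2k] a[4+2k]) (0<f (3 + double k)))
  where
  a≡c₅ : psum (5 + double k) a ≡ target k
  a≡c₅ = trans (sym (psum-2*k+n a (suc k) 3)) a≡c
  c<f₂ : target k < f (2 + double k)
  c<f₂ = target<f k
  c<f₃ : target k < f (3 + double k)
  c<f₃ = <-≤-trans c<f₂ (f-≤-suc (2 + double k))
  c<f₄ : target k < f (4 + double k)
  c<f₄ = <-≤-trans c<f₃ (f-≤-suc (3 + double k))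
  a[2+2k] : digit a (2 + double k) ≡ false
  a[2+2k] = small-psum⇒digit≡false a a≡c₅ c<f₂ (m<n+m _ {3} (s≤s z≤n))
  a[3+2k] : digit a (3 + double k) ≡ false
  a[3+2k] = small-psum⇒digit≡false a a≡c₅ c<f₃ (m<n+m _ {2} (s≤s z≤n))
  a[4+2k] : digit a (4 + double k) ≡ false
  a[4+2k] = small-psum⇒digit≡false a a≡c₅ c<f₄ (n<1+n _)
  a≡c₃ : psum (3 + double k) a ≡ target k
  a≡c₃ = trans (sym (psum-2+-false a _ a[3+2k] a[4+2k])) a≡c₅
  b = setDigit a (3 + double k) true
  rep-b : IsRep (y + f (3 + double k)) b
  rep-b = trans (value-set a (3 + double k) a[3+2k]) (cong (_+ f (3 + double k)) value-a) ,
          Admissible-set-odd a k adm a[2+2k] a[4+2k]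
  b≡c : psum (3 + double k) b ≡ target k
  b≡c = trans (psum-cong (3 + double k) (λ i → digit-setDigit-< a (3 + double k) true)) a≡c₃

successor-in-F″ : ∀ k {y a} → IsRep y a → psum (2 * k + 3) a ≡ target k → ¬ InF' k y →
  NextInF k y (y + f (2 * k + 2))
successor-in-F″ k {y} {a} rep@(value-a , adm) a≡c ¬F′ =
  subst (λ n → NextInF k y (y + f n)) (sym (2*k+n≡n+double k 2))
    (successor-in-F k rep rep-b a≡c₃ b≡c (Gap-double (suc k) adm a≡c₃) (0<f (2 + double k)))
  where
  a≡c₃ : psum (3 + double k) a ≡ target k
  a≡c₃ = trans (sym (psum-2*k+n a k 3)) a≡c
  a[2+2k] : digit a (2 + double k) ≡ false
  a[2+2k] = small-psum⇒digit≡false a a≡c₃ (target<f k) (n<1+n _)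
  occupied : digit a (3 + double k) ≡ true ⊎ digit a (4 + double k) ≡ true
  occupied with digit a (3 + double k) in a[3+2k] | digit a (4 + double k) in a[4+2k]
  ... | true | _ = inj₁ refl
  ... | false | true = inj₂ refl
  ... | false | false =
    ⊥-elim (¬F′ (a , rep , trans (psum-2*k+n a (suc k) 3) (trans (psum-2+-false a _ a[3+2k] a[4+2k]) a≡c₃)))
  zeros : ∀ i → suc k + length a ≤ i → digit a i ≡ false
  zeros i h = digit-≥-length a (≤-trans (m≤n+m _ _) h)
  open Increment (Increment-carry (length a) (suc k) a adm zeros a[2+2k] occupied)
    renaming (sum to b)
  rep-b : IsRep (y + f (2 + double k)) b
  rep-b = trans value-sum (cong (_+ f (2 + double k)) value-a) , admissible
  b≡c : psum (3 + double k) b ≡ target k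
  b≡c = trans (psum-cong (3 + double k) agrees) a≡c₃

lemma3 : (k y : ℕ) → InF k y →
    (InF' k y → NextInF k y (y + f (2 * k + 3)))
    × (¬ InF' k y → NextInF k y (y + f (2 * k + 2)))
lemma3 k y (a , rep , a≡c) =
  (λ { (a′ , rep′ , a′≡c) → successor-in-F′ k rep′ a′≡c }) ,
  successor-in-F″ k rep a≡c
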